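{- For real or complex $\alpha,\beta,\gamma,x,\lambda$ and every integer $n\ge0$, $$A^{\lambda,x}_n(\alpha,\beta,\gamma)=(-1)^n\sum_{k=0}^{n}\binom{k+\lambda-1}{k}(-\beta)^k k!\,S(n,k,\alpha,\beta,\beta\lambda-\gamma)\,(x+1)^k.$$
   Context: For a number $\alpha$ and integer $n\ge0$, $(t|\alpha)_n=t(t-\alpha)\cdots(t-(n-1)\alpha)$, $(t|\alpha)_0=1$. For numbers $\alpha,\beta,\gamma$ the generalised Stirling numbers $S(n,k,\alpha,\beta,\gamma)$, $0\le k\le n$, are defined by the polynomial identity $(t|\alpha)_n=\sum_{k=0}^{n}S(n,k,\alpha,\beta,\gamma)(t-\gamma|\beta)_k$ (the paper also writes $S_2$ for $S$). For a number $\lambda$ and integer $k\ge0$, $\binom{k+\lambda-1}{k}=\lambda(\lambda+1)\cdots(\lambda+k-1)/k!$ (equal to $1$ for $k=0$). Define $$A^{\lambda,x}_n(\alpha,\beta,\gamma)=\sum_{k=0}^{n}\binom{k+\lambda-1}{k}(-1)^{n+k}\beta^k k!\,S(n,k,\alpha,-\beta,-\gamma)\,x^k.$$ -}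

module Defs where

open import Level using (Level)
open import Data.Nat using (ℕ; zero; suc)
open import Algebra.Bundles using (CommutativeRing)

module _ {c ℓ : Level} (R : CommutativeRing c ℓ) where
  open CommutativeRing R hiding (zero)

  _·ₙ_ : ℕ → Carrier → Carrier
  zero ·ₙ a = 0#
  suc n ·ₙ a = a + (n ·ₙ a)

  pow : Carrier → ℕ → Carrier
  pow a zero = 1#
  pow a (suc n) = pow a n * a

  sgn : ℕ → Carrier
  sgn n = pow (- 1#) n

  sumTo : (ℕ → Carrier) → ℕ → Carrier
  sumTo f zero = f zero
  sumTo f (suc n) = sumTo f n + f (suc n)

  fall : Carrier → Carrier → ℕ → Carrier
  fall t a zero = 1#
  fall t a (suc n) = fall t a n * (t - (n ·ₙ a))

  -- binom(k+λ-1, k) · k!  =  λ (λ+1) ... (λ+k-1)   (rising factorial)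
  binomFact : Carrier → ℕ → Carrier
  binomFact λ′ zero = 1#
  binomFact λ′ (suc k) = binomFact λ′ k * (λ′ + (k ·ₙ 1#))

  -- Generalised Stirling numbers S(n,k,α,β,γ), i.e. the (unique) coefficients in
  --   (t|α)_n = Σ_{k=0}^{n} S(n,k,α,β,γ) (t-γ|β)_k .
  -- Computed by the recurrence obtained from (t|α)_{n+1} = (t|α)_n (t - nα) and
  --   (t-γ|β)_k (t - nα) = (t-γ|β)_{k+1} + (kβ + γ - nα) (t-γ|β)_k :
  --   S(0,0)=1, S(0,k+1)=0,
  --   S(n+1,0)   = (γ - nα) S(n,0),
  --   S(n+1,k+1) = S(n,k) + ((k+1)β + γ - nα) S(n,k+1).
  S : ℕ → ℕ → Carrier → Carrier → Carrier → Carrier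
  S zero zero α β γ = 1#
  S zero (suc k) α β γ = 0#
  S (suc n) zero α β γ = (γ - (n ·ₙ α)) * S n zero α β γ
  S (suc n) (suc k) α β γ =
    S n k α β γ + ((((suc k) ·ₙ β) + γ - (n ·ₙ α)) * S n (suc k) α β γ)

  A : Carrier → Carrier → ℕ → Carrier → Carrier → Carrier → Carrier
  A λ′ x n α β γ =
    sumTo (λ k → binomFact λ′ k * sgn (n Data.Nat.+ k) * pow β k
                   * S n k α (- β) (- γ) * pow x k) n

-- Put aₙₖ = ⟨λ⟩ₖ (-β)ᵏ S(n,k,α,-β,-γ) and bₙₖ = ⟨λ⟩ₖ (-β)ᵏ S(n,k,α,β,βλ-γ), where ⟨λ⟩ₖ is the
-- rising factorial.  As (-1)ⁿ⁺ᵏ βᵏ = (-1)ⁿ (-β)ᵏ, the theorem says Σₖ aₙₖ xᵏ = Σₖ bₙₖ (x+1)ᵏ.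
-- The triangular recurrence of S makes each row evolve in n by a first-order differential
-- operator on its generating polynomial, and the substitution y = x + 1 carries the operator
-- of the b-rows to that of the a-rows.  On coefficients this reads aₙⱼ = Σₖ C(k,j) bₙₖ, proved
-- by induction on n using (j+1) C(k,j+1) + j C(k,j) = k C(k,j); the binomial theorem then
-- turns Σⱼ aₙⱼ xʲ into Σₖ bₙₖ (x+1)ᵏ.
module Submission where

open import Defs
open import Level using (Level)
open import Algebra.Bundles using (CommutativeRing)
open import Data.Nat as ℕ using (ℕ; zero; suc; _≤_; _<_; z≤n; s≤s)
import Data.Nat.Properties as ℕ
open import Data.Integer as ℤ using (ℤ; +_; -[1+_]; _⊖_; _◃_)
import Data.Integer.Properties as ℤ
open import Data.Maybe.Base using (Maybe; map)
open import Data.Sign as Sign using (Sign)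
open import Relation.Binary.Consequences using (dec⇒weaklyDec)
import Relation.Binary.PropositionalEquality as ≡
import Relation.Binary.Reasoning.Setoid as SetoidReasoning
open import Algebra.Solver.Ring.AlmostCommutativeRing
  using (_-Raw-AlmostCommutative⟶_; fromCommutativeRing)

module IntegerCoefficientRingSolver {c ℓ : Level} (R : CommutativeRing c ℓ) where
  open CommutativeRing R
  open SetoidReasoning setoid
  open import Algebra.Properties.Ring ring using (-1*x≈-x)
  open import Algebra.Properties.AbelianGroup +-abelianGroup using (⁻¹-∙-comm)
  open import Algebra.Properties.Group +-group using (⁻¹-involutive; ε⁻¹≈ε)
  open import Algebra.Properties.CommutativeSemigroup *-commutativeSemigroup
    using (interchange)
  open import Algebra.Properties.CommutativeSemigroup +-commutativeSemigroup
    using () renaming (interchange to +-interchange)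
  open import Algebra.Properties.Semiring.Mult.TCOptimised semiring
    using (_×_; 1+×; ×-homo-+; ×1-homo-*)

  fromSign : Sign → Carrier
  fromSign Sign.+ = 1#
  fromSign Sign.- = - 1#

  -- The optimised _×_ has 1 × 1# = 1#, so the constants :0 and :1 below evaluate to 0# and 1#
  -- on the nose, as `solve … refl` requires.
  fromℤ : ℤ → Carrier
  fromℤ (+ n) = n × 1#
  fromℤ -[1+ n ] = - (suc n × 1#)

  fromSign-* : ∀ s t → fromSign (s Sign.* t) ≈ fromSign s * fromSign t
  fromSign-* Sign.+ t = sym (*-identityˡ _)
  fromSign-* Sign.- Sign.+ = sym (*-identityʳ _)
  fromSign-* Sign.- Sign.- = sym (trans (-1*x≈-x _) (⁻¹-involutive _))

  fromℤ-◃ : ∀ s n → fromℤ (s ◃ n) ≈ fromSign s * (n × 1#)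
  fromℤ-◃ s zero = sym (zeroʳ _)
  fromℤ-◃ Sign.+ (suc n) = sym (*-identityˡ _)
  fromℤ-◃ Sign.- (suc n) = sym (-1*x≈-x _)

  fromℤ-sign-abs : ∀ i → fromℤ i ≈ fromSign (ℤ.sign i) * (ℤ.∣ i ∣ × 1#)
  fromℤ-sign-abs i = begin
    fromℤ i                                   ≡⟨ ≡.cong fromℤ (≡.sym (ℤ.◃-inverse i)) ⟩
    fromℤ (ℤ.sign i ◃ ℤ.∣ i ∣)                ≈⟨ fromℤ-◃ (ℤ.sign i) ℤ.∣ i ∣ ⟩
    fromSign (ℤ.sign i) * (ℤ.∣ i ∣ × 1#)      ∎

  1+x-[1+y]≈x-y : ∀ x y → (1# + x) - (1# + y) ≈ x - y
  1+x-[1+y]≈x-y x y = begin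
    (1# + x) + - (1# + y)     ≈⟨ +-congˡ (⁻¹-∙-comm 1# y) ⟨
    (1# + x) + (- 1# + - y)   ≈⟨ +-interchange 1# x (- 1#) (- y) ⟩
    (1# - 1#) + (x - y)       ≈⟨ +-congʳ (-‿inverseʳ 1#) ⟩
    0# + (x - y)              ≈⟨ +-identityˡ _ ⟩
    x - y                     ∎

  fromℤ-⊖ : ∀ m n → fromℤ (m ⊖ n) ≈ m × 1# - n × 1#
  fromℤ-⊖ zero zero = sym (-‿inverseʳ 0#)
  fromℤ-⊖ (suc m) zero = sym (trans (+-congˡ ε⁻¹≈ε) (+-identityʳ _))
  fromℤ-⊖ zero (suc n) = sym (+-identityˡ _)
  fromℤ-⊖ (suc m) (suc n) = begin
    fromℤ (suc m ⊖ suc n)             ≡⟨ ≡.cong fromℤ (ℤ.[1+m]⊖[1+n]≡m⊖n m n) ⟩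
    fromℤ (m ⊖ n)                     ≈⟨ fromℤ-⊖ m n ⟩
    m × 1# - n × 1#                   ≈⟨ 1+x-[1+y]≈x-y _ _ ⟨
    (1# + m × 1#) - (1# + n × 1#)     ≈⟨ +-cong (1+× m 1#) (-‿cong (1+× n 1#)) ⟨
    suc m × 1# - suc n × 1#           ∎

  fromℤ-+ : ∀ i j → fromℤ (i ℤ.+ j) ≈ fromℤ i + fromℤ j
  fromℤ-+ -[1+ m ] -[1+ n ] = begin
    - (suc (suc (m ℕ.+ n)) × 1#)        ≡⟨ ≡.cong (λ k → - (suc k × 1#)) (≡.sym (ℕ.+-suc m n)) ⟩
    - ((suc m ℕ.+ suc n) × 1#)          ≈⟨ -‿cong (×-homo-+ 1# (suc m) (suc n)) ⟩
    - (suc m × 1# + suc n × 1#)         ≈⟨ ⁻¹-∙-comm _ _ ⟨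
    - (suc m × 1#) + - (suc n × 1#)     ∎
  fromℤ-+ -[1+ m ] (+ n) = trans (fromℤ-⊖ n (suc m)) (+-comm _ _)
  fromℤ-+ (+ m) -[1+ n ] = fromℤ-⊖ m (suc n)
  fromℤ-+ (+ m) (+ n) = ×-homo-+ 1# m n

  fromℤ-* : ∀ i j → fromℤ (i ℤ.* j) ≈ fromℤ i * fromℤ j
  fromℤ-* i j = begin
    fromℤ ((ℤ.sign i Sign.* ℤ.sign j) ◃ (ℤ.∣ i ∣ ℕ.* ℤ.∣ j ∣))
      ≈⟨ fromℤ-◃ (ℤ.sign i Sign.* ℤ.sign j) (ℤ.∣ i ∣ ℕ.* ℤ.∣ j ∣) ⟩
    fromSign (ℤ.sign i Sign.* ℤ.sign j) * ((ℤ.∣ i ∣ ℕ.* ℤ.∣ j ∣) × 1#)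
      ≈⟨ *-cong (fromSign-* (ℤ.sign i) (ℤ.sign j)) (×1-homo-* ℤ.∣ i ∣ ℤ.∣ j ∣) ⟩
    (fromSign (ℤ.sign i) * fromSign (ℤ.sign j)) * ((ℤ.∣ i ∣ × 1#) * (ℤ.∣ j ∣ × 1#))
      ≈⟨ interchange _ _ _ _ ⟩
    (fromSign (ℤ.sign i) * (ℤ.∣ i ∣ × 1#)) * (fromSign (ℤ.sign j) * (ℤ.∣ j ∣ × 1#))
      ≈⟨ *-cong (fromℤ-sign-abs i) (fromℤ-sign-abs j) ⟨
    fromℤ i * fromℤ j ∎

  fromℤ-neg : ∀ i → fromℤ (ℤ.- i) ≈ - fromℤ i
  fromℤ-neg -[1+ n ] = sym (⁻¹-involutive _)
  fromℤ-neg (+ zero) = sym ε⁻¹≈ε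
  fromℤ-neg (+ suc n) = refl

  fromℤ-homomorphism : ℤ.+-*-rawRing -Raw-AlmostCommutative⟶ fromCommutativeRing R
  fromℤ-homomorphism = record
    { ⟦_⟧ = fromℤ ; +-homo = fromℤ-+ ; *-homo = fromℤ-* ; -‿homo = fromℤ-neg
    ; 0-homo = refl ; 1-homo = refl }

  fromℤ-≈? : ∀ i j → Maybe (fromℤ i ≈ fromℤ j)
  fromℤ-≈? i j = map (λ i≡j → reflexive (≡.cong fromℤ i≡j)) (dec⇒weaklyDec ℤ._≟_ i j)

  open import Algebra.Solver.Ring ℤ.+-*-rawRing (fromCommutativeRing R) fromℤ-homomorphism fromℤ-≈?
    public

  :0 :1 : ∀ {n} → Polynomial n
  :0 = con (+ 0)
  :1 = con (+ 1)

module Sums {c ℓ : Level} (R : CommutativeRing c ℓ) where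
  open CommutativeRing R hiding (zero)
  open SetoidReasoning setoid
  open IntegerCoefficientRingSolver R using (solve; _:=_; _:+_; _:*_; :-_; :0; :1)
  open import Algebra.Properties.CommutativeSemigroup +-commutativeSemigroup
    using () renaming (interchange to +-interchange)

  ∑ : (ℕ → Carrier) → ℕ → Carrier
  ∑ = sumTo R

  _^_ : Carrier → ℕ → Carrier
  _^_ = pow R

  fromℕ : ℕ → Carrier
  fromℕ n = _·ₙ_ R n 1#

  ·ₙ≈fromℕ* : ∀ n a → _·ₙ_ R n a ≈ fromℕ n * a
  ·ₙ≈fromℕ* zero a = sym (zeroˡ a)
  ·ₙ≈fromℕ* (suc n) a = begin
    a + _·ₙ_ R n a       ≈⟨ +-congˡ (·ₙ≈fromℕ* n a) ⟩
    a + fromℕ n * a      ≈⟨ solve 2 (λ a m → a :+ m :* a := (:1 :+ m) :* a) refl a (fromℕ n) ⟩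
    (1# + fromℕ n) * a   ∎

  ∑-cong : ∀ {f g} → (∀ k → f k ≈ g k) → ∀ n → ∑ f n ≈ ∑ g n
  ∑-cong f≈g zero = f≈g zero
  ∑-cong f≈g (suc n) = +-cong (∑-cong f≈g n) (f≈g (suc n))

  ∑-cong-≤ : ∀ {f g} n → (∀ k → k ≤ n → f k ≈ g k) → ∑ f n ≈ ∑ g n
  ∑-cong-≤ zero f≈g = f≈g zero z≤n
  ∑-cong-≤ (suc n) f≈g =
    +-cong (∑-cong-≤ n (λ k k≤n → f≈g k (ℕ.m≤n⇒m≤1+n k≤n))) (f≈g (suc n) ℕ.≤-refl)

  ∑-distrib-+ : ∀ f g n → ∑ (λ k → f k + g k) n ≈ ∑ f n + ∑ g n
  ∑-distrib-+ f g zero = refl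
  ∑-distrib-+ f g (suc n) = trans (+-congʳ (∑-distrib-+ f g n)) (+-interchange _ _ _ _)

  *-distribˡ-∑ : ∀ a f n → a * ∑ f n ≈ ∑ (λ k → a * f k) n
  *-distribˡ-∑ a f zero = refl
  *-distribˡ-∑ a f (suc n) = trans (distribˡ _ _ _) (+-congʳ (*-distribˡ-∑ a f n))

  *-distribʳ-∑ : ∀ a f n → ∑ f n * a ≈ ∑ (λ k → f k * a) n
  *-distribʳ-∑ a f zero = refl
  *-distribʳ-∑ a f (suc n) = trans (distribʳ _ _ _) (+-congʳ (*-distribʳ-∑ a f n))

  ∑-head : ∀ f n → ∑ f (suc n) ≈ f 0 + ∑ (λ k → f (suc k)) n
  ∑-head f zero = refl
  ∑-head f (suc n) = trans (+-congʳ (∑-head f n)) (+-assoc _ _ _)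

  ∑-comm : ∀ (g : ℕ → ℕ → Carrier) m n →
           ∑ (λ j → ∑ (λ k → g j k) m) n ≈ ∑ (λ k → ∑ (λ j → g j k) n) m
  ∑-comm g m zero = refl
  ∑-comm g m (suc n) = trans (+-congʳ (∑-comm g m n)) (sym (∑-distrib-+ _ _ m))

  ^-distribˡ-+-* : ∀ a m n → a ^ (m ℕ.+ n) ≈ a ^ m * a ^ n
  ^-distribˡ-+-* a zero n = sym (*-identityˡ _)
  ^-distribˡ-+-* a (suc m) n = trans (*-congʳ (^-distribˡ-+-* a m n))
    (solve 3 (λ p q a → p :* q :* a := p :* a :* q) refl (a ^ m) (a ^ n) a)

  neg-^ : ∀ a k → (- a) ^ k ≈ sgn R k * a ^ k
  neg-^ a zero = sym (*-identityˡ 1#)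
  neg-^ a (suc k) = trans (*-congʳ (neg-^ a k))
    (solve 3 (λ s p a → s :* p :* (:- a) := s :* (:- :1) :* (p :* a)) refl (sgn R k) (a ^ k) a)

  binomial : ℕ → ℕ → Carrier
  binomial k zero = 1#
  binomial zero (suc j) = 0#
  binomial (suc k) (suc j) = binomial k j + binomial k (suc j)

  binomial-absorption : ∀ k j →
    fromℕ (suc j) * binomial k (suc j) + fromℕ j * binomial k j ≈ fromℕ k * binomial k j
  binomial-absorption zero zero =
    solve 0 ((:1 :+ :0) :* :0 :+ :0 :* :1 := :0 :* :1) refl
  binomial-absorption zero (suc j) =
    solve 1 (λ J → (:1 :+ J) :* :0 :+ J :* :0 := :0 :* :0) refl (fromℕ (suc j))
  binomial-absorption (suc k) zero = begin
    (1# + 0#) * (1# + binomial k 1) + 0# * 1#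
      ≈⟨ solve 1 (λ b → (:1 :+ :0) :* (:1 :+ b) :+ :0 :* :1
                     := :1 :+ ((:1 :+ :0) :* b :+ :0 :* :1)) refl (binomial k 1) ⟩
    1# + ((1# + 0#) * binomial k 1 + 0# * 1#)
      ≈⟨ +-congˡ (binomial-absorption k zero) ⟩
    1# + fromℕ k * 1#
      ≈⟨ solve 1 (λ K → :1 :+ K :* :1 := (:1 :+ K) :* :1) refl (fromℕ k) ⟩
    (1# + fromℕ k) * 1# ∎
  binomial-absorption (suc k) (suc j) = begin
    (1# + J′) * (b′ + b″) + J′ * (b + b′)
      ≈⟨ solve 4 (λ J b b′ b″ →
                    (:1 :+ (:1 :+ J)) :* (b′ :+ b″) :+ (:1 :+ J) :* (b :+ b′)
                 := ((:1 :+ (:1 :+ J)) :* b″ :+ (:1 :+ J) :* b′) :+ ((:1 :+ J) :* b′ :+ J :* b) :+ (b :+ b′))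
           refl (fromℕ j) b b′ b″ ⟩
    (fromℕ (suc (suc j)) * b″ + J′ * b′) + (J′ * b′ + fromℕ j * b) + (b + b′)
      ≈⟨ +-congʳ (+-cong (binomial-absorption k (suc j)) (binomial-absorption k j)) ⟩
    fromℕ k * b′ + fromℕ k * b + (b + b′)
      ≈⟨ solve 3 (λ K b b′ → K :* b′ :+ K :* b :+ (b :+ b′) := (:1 :+ K) :* (b :+ b′))
           refl (fromℕ k) b b′ ⟩
    (1# + fromℕ k) * (b + b′) ∎
    where
    J′ = fromℕ (suc j)
    b = binomial k j
    b′ = binomial k (suc j)
    b″ = binomial k (suc (suc j))

  binomial-theorem : ∀ x k N → k ≤ N → ∑ (λ j → binomial k j * x ^ j) N ≈ (x + 1#) ^ k
  binomial-theorem x zero zero _ = *-identityʳ 1#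
  binomial-theorem x zero (suc N) _ =
    trans (+-cong (binomial-theorem x zero N z≤n) (zeroˡ _)) (+-identityʳ 1#)
  binomial-theorem x (suc k) (suc N) (s≤s k≤N) = begin
    ∑ (λ j → binomial (suc k) j * x ^ j) (suc N)
      ≈⟨ ∑-head _ N ⟩
    1# * 1# + ∑ (λ i → (binomial k i + binomial k (suc i)) * (x ^ i * x)) N
      ≈⟨ +-congˡ (∑-cong (λ i → solve 4 (λ b b′ p x → (b :+ b′) :* (p :* x)
                                                      := b :* p :* x :+ b′ :* (p :* x))
                                        refl (binomial k i) (binomial k (suc i)) (x ^ i) x) N) ⟩
    1# * 1# + ∑ (λ i → binomial k i * x ^ i * x + binomial k (suc i) * x ^ suc i) N
      ≈⟨ +-congˡ (trans (∑-distrib-+ _ _ N) (+-congʳ (sym (*-distribʳ-∑ x _ N)))) ⟩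
    1# * 1# + (∑ (λ i → binomial k i * x ^ i) N * x + ∑ (λ i → binomial k (suc i) * x ^ suc i) N)
      ≈⟨ solve 3 (λ u v w → u :+ (v :+ w) := v :+ (u :+ w)) refl (1# * 1#) _ _ ⟩
    ∑ (λ i → binomial k i * x ^ i) N * x + (1# * 1# + ∑ (λ i → binomial k (suc i) * x ^ suc i) N)
      ≈⟨ +-congˡ (sym (∑-head _ N)) ⟩
    ∑ (λ i → binomial k i * x ^ i) N * x + ∑ (λ i → binomial k i * x ^ i) (suc N)
      ≈⟨ +-cong (*-congʳ (binomial-theorem x k N k≤N))
                (binomial-theorem x k (suc N) (ℕ.m≤n⇒m≤1+n k≤N)) ⟩
    (x + 1#) ^ k * x + (x + 1#) ^ k
      ≈⟨ solve 2 (λ p x → p :* x :+ p := p :* (x :+ :1)) refl _ x ⟩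
    (x + 1#) ^ suc k ∎

  taylorShift : (ℕ → Carrier) → ℕ → ℕ → Carrier
  taylorShift c N j = ∑ (λ k → binomial k j * c k) N

  taylorShift-eval : ∀ c x N →
    ∑ (λ j → taylorShift c N j * x ^ j) N ≈ ∑ (λ k → c k * (x + 1#) ^ k) N
  taylorShift-eval c x N = begin
    ∑ (λ j → taylorShift c N j * x ^ j) N
      ≈⟨ ∑-cong (λ j → *-distribʳ-∑ (x ^ j) _ N) N ⟩
    ∑ (λ j → ∑ (λ k → binomial k j * c k * x ^ j) N) N
      ≈⟨ ∑-comm (λ j k → binomial k j * c k * x ^ j) N N ⟩
    ∑ (λ k → ∑ (λ j → binomial k j * c k * x ^ j) N) N
      ≈⟨ ∑-cong (λ k → trans (∑-cong (λ j → solve 3 (λ b c p → b :* c :* p := c :* (b :* p))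
                                                     refl _ _ _) N)
                               (sym (*-distribˡ-∑ (c k) _ N))) N ⟩
    ∑ (λ k → c k * ∑ (λ j → binomial k j * x ^ j) N) N
      ≈⟨ ∑-cong-≤ N (λ k k≤N → *-congˡ (binomial-theorem x k N k≤N)) ⟩
    ∑ (λ k → c k * (x + 1#) ^ k) N ∎

module Stirling {c ℓ : Level} (R : CommutativeRing c ℓ) (α λ′ : CommutativeRing.Carrier R) where
  open CommutativeRing R hiding (zero)
  open SetoidReasoning setoid
  open IntegerCoefficientRingSolver R using (solve; _:=_; _:+_; _:*_; _:-_; :-_; :0; :1)
  open Sums R

  n<k⇒S≈0 : ∀ {n k} β γ → n < k → S R n k α β γ ≈ 0#
  n<k⇒S≈0 {zero} {suc k} β γ _ = refl
  n<k⇒S≈0 {suc n} {suc k} β γ (s≤s n<k) = begin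
    S R n k α β γ + _ * S R n (suc k) α β γ
      ≈⟨ +-cong (n<k⇒S≈0 β γ n<k) (*-congˡ (n<k⇒S≈0 β γ (ℕ.m<n⇒m<1+n n<k))) ⟩
    0# + _ * 0#
      ≈⟨ trans (+-identityˡ _) (zeroʳ _) ⟩
    0# ∎

  S-suc-zero : ∀ n β γ → S R (suc n) 0 α β γ ≈ (γ - fromℕ n * α) * S R n 0 α β γ
  S-suc-zero n β γ = *-congʳ (+-congˡ (-‿cong (·ₙ≈fromℕ* n α)))

  S-suc-suc : ∀ n k β γ → S R (suc n) (suc k) α β γ
    ≈ S R n k α β γ + (fromℕ (suc k) * β + γ - fromℕ n * α) * S R n (suc k) α β γ
  S-suc-suc n k β γ =
    +-congˡ (*-congʳ (+-cong (+-congʳ (·ₙ≈fromℕ* (suc k) β)) (-‿cong (·ₙ≈fromℕ* n α))))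

  weightedS : Carrier → Carrier → Carrier → ℕ → ℕ → Carrier
  weightedS μ β γ n k = binomFact R λ′ k * μ ^ k * S R n k α β γ

  raise : Carrier → (ℕ → Carrier) → ℕ → Carrier
  raise μ f zero = 0#
  raise μ f (suc k) = (λ′ + fromℕ k) * μ * f k

  -- On generating polynomials Σₖ f k yᵏ, stirlingStep μ β γ s acts as
  -- μ y (λ′ + y ∂) + β y ∂ + γ - s.  For μ = -β, substituting y = x + 1 turns the operator
  -- for (β, βλ′ - γ) into the one for (-β, -γ).
  stirlingStep : (μ β γ s : Carrier) → (ℕ → Carrier) → ℕ → Carrier
  stirlingStep μ β γ s f k = raise μ f k + (fromℕ k * β + γ - s) * f k

  weightedS-suc : ∀ μ β γ n k →
    weightedS μ β γ (suc n) k ≈ stirlingStep μ β γ (fromℕ n * α) (weightedS μ β γ n) k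
  weightedS-suc μ β γ n zero = trans (*-congˡ (S-suc-zero n β γ))
    (solve 5 (λ γ N α β S₀ → :1 :* :1 :* ((γ :- N :* α) :* S₀)
                           := :0 :+ (:0 :* β :+ γ :- N :* α) :* (:1 :* :1 :* S₀))
      refl γ (fromℕ n) α β (S R n 0 α β γ))
  weightedS-suc μ β γ n (suc k) = trans (*-congˡ (S-suc-suc n k β γ))
    (solve 11 (λ r l K p μ β γ N α S S′ →
          r :* (l :+ K) :* (p :* μ) :* (S :+ ((:1 :+ K) :* β :+ γ :- N :* α) :* S′)
       := (l :+ K) :* μ :* (r :* p :* S)
            :+ ((:1 :+ K) :* β :+ γ :- N :* α) :* (r :* (l :+ K) :* (p :* μ) :* S′))
      refl (binomFact R λ′ k) λ′ (fromℕ k) (μ ^ k) μ β γ (fromℕ n) α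
           (S R n k α β γ) (S R n (suc k) α β γ))

  stirlingStep-cong : ∀ μ β γ s {f g} → (∀ k → f k ≈ g k) →
    ∀ j → stirlingStep μ β γ s f j ≈ stirlingStep μ β γ s g j
  stirlingStep-cong μ β γ s f≈g zero = +-congˡ (*-congˡ (f≈g 0))
  stirlingStep-cong μ β γ s f≈g (suc j) = +-cong (*-congˡ (f≈g j)) (*-congˡ (f≈g (suc j)))

  stirlingStep-∑ : ∀ μ β γ s (g : ℕ → ℕ → Carrier) (c : ℕ → Carrier) N j →
    stirlingStep μ β γ s (λ i → ∑ (λ k → g k i * c k) N) j
      ≈ ∑ (λ k → stirlingStep μ β γ s (g k) j * c k) N
  stirlingStep-∑ μ β γ s g c N zero = begin
    0# + d * ∑ (λ k → g k 0 * c k) N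
      ≈⟨ trans (+-identityˡ _) (*-distribˡ-∑ d _ N) ⟩
    ∑ (λ k → d * (g k 0 * c k)) N
      ≈⟨ ∑-cong (λ k → solve 3 (λ d g c → d :* (g :* c) := (:0 :+ d :* g) :* c) refl d (g k 0) (c k)) N ⟩
    ∑ (λ k → (0# + d * g k 0) * c k) N ∎
    where d = fromℕ 0 * β + γ - s
  stirlingStep-∑ μ β γ s g c N (suc j) = begin
    u * ∑ (λ k → g k j * c k) N + v * ∑ (λ k → g k (suc j) * c k) N
      ≈⟨ +-cong (*-distribˡ-∑ u _ N) (*-distribˡ-∑ v _ N) ⟩
    ∑ (λ k → u * (g k j * c k)) N + ∑ (λ k → v * (g k (suc j) * c k)) N
      ≈⟨ sym (∑-distrib-+ _ _ N) ⟩
    ∑ (λ k → u * (g k j * c k) + v * (g k (suc j) * c k)) N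
      ≈⟨ ∑-cong (λ k → solve 5 (λ u v g g′ c → u :* (g :* c) :+ v :* (g′ :* c)
                                            := (u :* g :+ v :* g′) :* c)
                               refl u v (g k j) (g k (suc j)) (c k)) N ⟩
    ∑ (λ k → (u * g k j + v * g k (suc j)) * c k) N ∎
    where
    u = (λ′ + fromℕ j) * μ
    v = fromℕ (suc j) * β + γ - s

  stirlingStep-binomial : ∀ β γ s k j →
    stirlingStep (- β) (- β) (- γ) s (binomial k) j
      ≈ binomial (suc k) j * ((λ′ + fromℕ k) * - β)
          + binomial k j * (fromℕ k * β + (β * λ′ - γ) - s)
  stirlingStep-binomial β γ s k zero =
    solve 5 (λ l K β γ s → :0 :+ (:0 :* (:- β) :+ (:- γ) :- s) :* :1
                            := :1 :* ((l :+ K) :* (:- β)) :+ :1 :* (K :* β :+ (β :* l :- γ) :- s))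
      refl λ′ (fromℕ k) β γ s
  stirlingStep-binomial β γ s k (suc j) = begin
    (λ′ + fromℕ j) * - β * b + (fromℕ (suc j) * - β + - γ - s) * b′
      ≈⟨ solve 7 (λ l J β γ s b b′ →
                    (l :+ J) :* (:- β) :* b :+ ((:1 :+ J) :* (:- β) :+ (:- γ) :- s) :* b′
                 := l :* (:- β) :* b :- (γ :+ s) :* b′ :- β :* ((:1 :+ J) :* b′ :+ J :* b))
           refl λ′ (fromℕ j) β γ s b b′ ⟩
    λ′ * - β * b - (γ + s) * b′ - β * (fromℕ (suc j) * b′ + fromℕ j * b)
      ≈⟨ +-congˡ (-‿cong (*-congˡ (binomial-absorption k j))) ⟩
    λ′ * - β * b - (γ + s) * b′ - β * (fromℕ k * b)
      ≈⟨ solve 7 (λ l K β γ s b b′ →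
                    l :* (:- β) :* b :- (γ :+ s) :* b′ :- β :* (K :* b)
                 := (b :+ b′) :* ((l :+ K) :* (:- β)) :+ b′ :* (K :* β :+ (β :* l :- γ) :- s))
           refl λ′ (fromℕ k) β γ s b b′ ⟩
    (b + b′) * ((λ′ + fromℕ k) * - β) + b′ * (fromℕ k * β + (β * λ′ - γ) - s) ∎
    where
    b = binomial k j
    b′ = binomial k (suc j)

  ∑-binomial-stirlingStep : ∀ μ β γ s (c : ℕ → Carrier) N j → c (suc N) ≈ 0# →
    ∑ (λ k → binomial k j * stirlingStep μ β γ s c k) (suc N)
      ≈ ∑ (λ k → (binomial (suc k) j * ((λ′ + fromℕ k) * μ)
                    + binomial k j * (fromℕ k * β + γ - s)) * c k) N
  ∑-binomial-stirlingStep μ β γ s c N j c[1+N]≈0 = begin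
    ∑ (λ k → binomial k j * (raise μ c k + d k * c k)) (suc N)
      ≈⟨ trans (∑-cong (λ k → distribˡ _ _ _) (suc N)) (∑-distrib-+ _ _ (suc N)) ⟩
    ∑ (λ k → binomial k j * raise μ c k) (suc N) + ∑ (λ k → binomial k j * (d k * c k)) (suc N)
      ≈⟨ +-cong (∑-head _ N) refl ⟩
    (binomial 0 j * 0# + ∑ (λ k → binomial (suc k) j * raise μ c (suc k)) N)
      + (∑ (λ k → binomial k j * (d k * c k)) N + binomial (suc N) j * (d (suc N) * c (suc N)))
      ≈⟨ +-cong (trans (+-congʳ (zeroʳ _)) (+-identityˡ _)) (trans (+-congˡ top-vanishes) (+-identityʳ _)) ⟩
    ∑ (λ k → binomial (suc k) j * raise μ c (suc k)) N + ∑ (λ k → binomial k j * (d k * c k)) N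
      ≈⟨ sym (∑-distrib-+ _ _ N) ⟩
    ∑ (λ k → binomial (suc k) j * ((λ′ + fromℕ k) * μ * c k) + binomial k j * (d k * c k)) N
      ≈⟨ ∑-cong (λ k → solve 5 (λ b′ u b d c → b′ :* (u :* c) :+ b :* (d :* c)
                                             := (b′ :* u :+ b :* d) :* c)
                               refl (binomial (suc k) j) ((λ′ + fromℕ k) * μ) (binomial k j) (d k) (c k)) N ⟩
    ∑ (λ k → (binomial (suc k) j * ((λ′ + fromℕ k) * μ) + binomial k j * d k) * c k) N ∎
    where
    d : ℕ → Carrier
    d k = fromℕ k * β + γ - s
    top-vanishes : binomial (suc N) j * (d (suc N) * c (suc N)) ≈ 0#
    top-vanishes = trans (*-congˡ (trans (*-congˡ c[1+N]≈0) (zeroʳ _))) (zeroʳ _)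

  stirlingStep-taylorShift : ∀ β γ s (c : ℕ → Carrier) N → c (suc N) ≈ 0# → ∀ j →
    stirlingStep (- β) (- β) (- γ) s (taylorShift c N) j
      ≈ taylorShift (stirlingStep (- β) β (β * λ′ - γ) s c) (suc N) j
  stirlingStep-taylorShift β γ s c N c[1+N]≈0 j = begin
    stirlingStep (- β) (- β) (- γ) s (taylorShift c N) j
      ≈⟨ stirlingStep-∑ (- β) (- β) (- γ) s binomial c N j ⟩
    ∑ (λ k → stirlingStep (- β) (- β) (- γ) s (binomial k) j * c k) N
      ≈⟨ ∑-cong (λ k → *-congʳ (stirlingStep-binomial β γ s k j)) N ⟩
    ∑ (λ k → (binomial (suc k) j * ((λ′ + fromℕ k) * - β)
                + binomial k j * (fromℕ k * β + (β * λ′ - γ) - s)) * c k) N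
      ≈⟨ sym (∑-binomial-stirlingStep (- β) β (β * λ′ - γ) s c N j c[1+N]≈0) ⟩
    taylorShift (stirlingStep (- β) β (β * λ′ - γ) s c) (suc N) j ∎

  weightedS-taylorShift : ∀ β γ n j →
    weightedS (- β) (- β) (- γ) n j ≈ taylorShift (weightedS (- β) β (β * λ′ - γ) n) n j
  weightedS-taylorShift β γ zero zero = sym (*-identityˡ _)
  weightedS-taylorShift β γ zero (suc j) = trans (zeroʳ _) (sym (zeroˡ _))
  weightedS-taylorShift β γ (suc n) j = begin
    weightedS (- β) (- β) (- γ) (suc n) j
      ≈⟨ weightedS-suc (- β) (- β) (- γ) n j ⟩
    stirlingStep (- β) (- β) (- γ) s (weightedS (- β) (- β) (- γ) n) j
      ≈⟨ stirlingStep-cong (- β) (- β) (- γ) s (weightedS-taylorShift β γ n) j ⟩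
    stirlingStep (- β) (- β) (- γ) s (taylorShift (weightedS (- β) β γ′ n) n) j
      ≈⟨ stirlingStep-taylorShift β γ s (weightedS (- β) β γ′ n) n top-vanishes j ⟩
    taylorShift (stirlingStep (- β) β γ′ s (weightedS (- β) β γ′ n)) (suc n) j
      ≈⟨ ∑-cong (λ k → *-congˡ (sym (weightedS-suc (- β) β γ′ n k))) (suc n) ⟩
    taylorShift (weightedS (- β) β γ′ (suc n)) (suc n) j ∎
    where
    s = fromℕ n * α
    γ′ = β * λ′ - γ
    top-vanishes : weightedS (- β) β γ′ n (suc n) ≈ 0#
    top-vanishes = trans (*-congˡ (n<k⇒S≈0 β γ′ (ℕ.n<1+n n))) (zeroʳ _)

mainTheorem7 : {c ℓ : Level} (R : CommutativeRing c ℓ) →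
    let open CommutativeRing R in
    (α β γ x λ′ : Carrier) (n : ℕ) →
    A R λ′ x n α β γ
      ≈ sgn R n * sumTo R (λ k → binomFact R λ′ k * pow R (- β) k
                                 * S R n k α β ((β * λ′) - γ) * pow R (x + 1#) k) n
mainTheorem7 R α β γ x λ′ n = begin
  ∑ (λ k → binomFact R λ′ k * sgn R (n ℕ.+ k) * β ^ k * S R n k α (- β) (- γ) * x ^ k) n
    ≈⟨ ∑-cong sign-split n ⟩
  ∑ (λ k → sgn R n * (weightedS (- β) (- β) (- γ) n k * x ^ k)) n
    ≈⟨ sym (*-distribˡ-∑ (sgn R n) _ n) ⟩
  sgn R n * ∑ (λ k → weightedS (- β) (- β) (- γ) n k * x ^ k) n
    ≈⟨ *-congˡ (∑-cong (λ k → *-congʳ (weightedS-taylorShift β γ n k)) n) ⟩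
  sgn R n * ∑ (λ k → taylorShift (weightedS (- β) β (β * λ′ - γ) n) n k * x ^ k) n
    ≈⟨ *-congˡ (taylorShift-eval _ x n) ⟩
  sgn R n * ∑ (λ k → weightedS (- β) β (β * λ′ - γ) n k * (x + 1#) ^ k) n ∎
  where
  open CommutativeRing R hiding (zero)
  open SetoidReasoning setoid
  open IntegerCoefficientRingSolver R using (solve; _:=_; _:*_)
  open Sums R
  open Stirling R α λ′

  sign-split : ∀ k → binomFact R λ′ k * sgn R (n ℕ.+ k) * β ^ k * S R n k α (- β) (- γ) * x ^ k
                   ≈ sgn R n * (weightedS (- β) (- β) (- γ) n k * x ^ k)
  sign-split k = begin
    r * sgn R (n ℕ.+ k) * β ^ k * s * x ^ k
      ≈⟨ *-congʳ (*-congʳ (*-congʳ (*-congˡ (^-distribˡ-+-* (- 1#) n k)))) ⟩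
    r * (sgn R n * sgn R k) * β ^ k * s * x ^ k
      ≈⟨ solve 6 (λ r σₙ σₖ p s X → r :* (σₙ :* σₖ) :* p :* s :* X
                                  := σₙ :* (r :* (σₖ :* p) :* s :* X))
           refl r (sgn R n) (sgn R k) (β ^ k) s (x ^ k) ⟩
    sgn R n * (r * (sgn R k * β ^ k) * s * x ^ k)
      ≈⟨ *-congˡ (*-congʳ (*-congʳ (*-congˡ (sym (neg-^ β k))))) ⟩
    sgn R n * (r * (- β) ^ k * s * x ^ k) ∎
    where
    r = binomFact R λ′ k
    s = S R n k α (- β) (- γ)
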